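{- Let $m\in\mathbb N$ and let $G$ be a non-empty rayless graph (possibly infinite) in which every vertex has degree at least $m$. Then $G$ has a non-empty finite subgraph in which every vertex has degree at least $m$.
   Context: A ray is a one-way infinite path; a graph is rayless if it contains no ray. Vertex degrees in $G$ may be infinite. -}

module Defs where

open import Data.Nat using (ℕ; suc)
open import Data.Fin using (Fin)
open import Data.Product using (Σ; _×_; ∃)
open import Data.List using (List)
open import Data.List.Membership.Propositional using (_∈_)
open import Relation.Binary.PropositionalEquality using (_≡_)
open import Relation.Nullary using (¬_)
open import Function.Definitions using (Injective)

record Graph : Set₁ where
  field
    V     : Set
    Adj   : V → V → Set
    sym   : ∀ {u v} → Adj u v → Adj v u
    irrefl : ∀ {v} → ¬ Adj v v
open Graph public

record Ray (G : Graph) : Set where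
  field
    vertex    : ℕ → V G
    injective : Injective _≡_ _≡_ vertex
    adjacent  : ∀ n → Adj G (vertex n) (vertex (suc n))

Rayless : Graph → Set
Rayless G = ¬ Ray G

DegAtLeast : (G : Graph) → ℕ → V G → Set
DegAtLeast G m v =
  Σ (Fin m → V G) λ f → Injective _≡_ _≡_ f × (∀ i → Adj G v (f i))

MinDegAtLeast : Graph → ℕ → Set
MinDegAtLeast G m = ∀ v → DegAtLeast G m v

NonEmpty : Graph → Set
NonEmpty G = V G

InducedMinDegAtLeast : (G : Graph) → ℕ → List (V G) → Set
InducedMinDegAtLeast G m H =
  ∀ {v} → v ∈ H →
    Σ (Fin m → V G) λ f →
      Injective _≡_ _≡_ f × (∀ i → (f i ∈ H) × Adj G v (f i))

HasFiniteMinDegSubgraph : Graph → ℕ → Set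
HasFiniteMinDegSubgraph G m =
  Σ (List (V G)) λ H → (∃ λ v → v ∈ H) × InducedMinDegAtLeast G m H

-- Fix for every vertex x a family N x of m distinct neighbours. Call u closable
-- modulo a finite set S if u ∈ S or u lies in a finite L with N x ⊆ L ∪ S for all
-- x ∈ L. A vertex closable modulo ∅ gives the finite subgraph. If u is not closable
-- modulo S then, classically, some neighbour N u i is not closable modulo u ∷ S,
-- since otherwise u together with the union of their witnesses would witness it;
-- in particular N u i ∉ u ∷ S. Always stepping to such a neighbour, starting from
-- a vertex not closable modulo ∅, never revisits a vertex and so traces a ray.
module Submission where

open import Defs
open import Data.Nat using (ℕ; zero; suc; _<_)
open import Data.Nat.Properties using (<-cmp; m<1+n⇒m<n∨m≡n)
open import Level using (0ℓ)
open import Axiom.ExcludedMiddle using (ExcludedMiddle)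
open import Data.Fin using (Fin)
open import Data.Fin.Properties using (¬∀⟶∃¬)
open import Data.List using (List; []; _∷_; concat; tabulate)
open import Data.List.Membership.Propositional using (_∈_; _∉_)
open import Data.List.Membership.Propositional.Properties
  using (∈-concat⁺′; ∈-concat⁻′; ∈-tabulate⁺; ∈-tabulate⁻)
open import Data.List.Relation.Unary.Any using (here; there)
open import Data.Product using (Σ; _×_; _,_; proj₁; proj₂)
open import Data.Sum using (_⊎_; inj₁; inj₂)
open import Relation.Nullary using (¬_; yes; no; contradiction)
open import Relation.Binary.PropositionalEquality using (_≡_; refl; subst) renaming (sym to ≡-sym)
open import Relation.Binary using (tri<; tri≈; tri>)
open import Function.Definitions using (Injective)

module _ {A : Set} (x : ℕ → A) (seen : ℕ → List A)
         (seen-suc : ∀ n → seen (suc n) ≡ x n ∷ seen n) where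

  earlier-seen : ∀ {k n} → k < n → x k ∈ seen n
  earlier-seen {k} {suc n} k<1+n rewrite seen-suc n with m<1+n⇒m<n∨m≡n k<1+n
  ... | inj₁ k<n  = there (earlier-seen k<n)
  ... | inj₂ refl = here refl

  fresh⇒injective : (∀ n → x n ∉ seen n) → Injective _≡_ _≡_ x
  fresh⇒injective fresh {k} {n} xk≡xn with <-cmp k n
  ... | tri< k<n _ _ = contradiction (subst (_∈ seen n) xk≡xn (earlier-seen k<n)) (fresh n)
  ... | tri≈ _ k≡n _ = k≡n
  ... | tri> _ _ n<k =
    contradiction (subst (_∈ seen k) (≡-sym xk≡xn) (earlier-seen n<k)) (fresh k)

module Closability {A : Set} {m : ℕ} (N : A → Fin m → A) where

  ClosedModulo : List A → List A → Set
  ClosedModulo S L = ∀ {x} → x ∈ L → ∀ i → N x i ∈ L ⊎ N x i ∈ S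

  Closable : List A → A → Set
  Closable S u = Σ (List A) λ L → (u ∈ L ⊎ u ∈ S) × ClosedModulo S L

  member⇒closable : ∀ {S u} → u ∈ S → Closable S u
  member⇒closable u∈S = [] , inj₂ u∈S , λ ()

  neighbours-closable⇒closable : ∀ {S u} →
    (∀ i → Closable (u ∷ S) (N u i)) → Closable S u
  neighbours-closable⇒closable {S} {u} closable =
    u ∷ concat parts , inj₁ (here refl) , closed
    where
    parts : List (List A)
    parts = tabulate (λ i → proj₁ (closable i))

    absorb : ∀ i {y} → y ∈ proj₁ (closable i) ⊎ y ∈ u ∷ S →
             y ∈ u ∷ concat parts ⊎ y ∈ S
    absorb i (inj₁ y∈Lᵢ)        = inj₁ (there (∈-concat⁺′ y∈Lᵢ (∈-tabulate⁺ i)))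
    absorb i (inj₂ (here y≡u))  = inj₁ (here y≡u)
    absorb i (inj₂ (there y∈S)) = inj₂ y∈S

    closed : ClosedModulo S (u ∷ concat parts)
    closed (here refl) i = absorb i (proj₁ (proj₂ (closable i)))
    closed (there x∈parts) j with ∈-concat⁻′ parts x∈parts
    ... | _ , x∈Lᵢ , Lᵢ∈parts with ∈-tabulate⁻ Lᵢ∈parts
    ... | i , refl = absorb i (proj₂ (proj₂ (closable i)) x∈Lᵢ j)

  unclosable-neighbour : ExcludedMiddle 0ℓ → ∀ {S u} → ¬ Closable S u →
    Σ (Fin m) λ i → ¬ Closable (u ∷ S) (N u i)
  unclosable-neighbour em {S} {u} ¬closable =
    ¬∀⟶∃¬ m (λ i → Closable (u ∷ S) (N u i)) (λ _ → em)
      (λ closable → ¬closable (neighbours-closable⇒closable closable))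

module _ (G : Graph) {m : ℕ} (δ : MinDegAtLeast G m) where

  neighbours : V G → Fin m → V G
  neighbours x = proj₁ (δ x)

  open Closability neighbours

  closable⇒finite-subgraph : ∀ {u} → Closable [] u → HasFiniteMinDegSubgraph G m
  closable⇒finite-subgraph (_ , inj₂ () , _)
  closable⇒finite-subgraph {u} (L , inj₁ u∈L , closed) =
    L , (u , u∈L) , λ {x} x∈L →
      neighbours x , proj₁ (proj₂ (δ x)) ,
      λ i → inside (closed x∈L i) , proj₂ (proj₂ (δ x)) i
    where
    inside : ∀ {y} → y ∈ L ⊎ y ∈ [] → y ∈ L
    inside (inj₁ y∈L) = y∈L

  module _ (em : ExcludedMiddle 0ℓ) where

    Walker : Set
    Walker = Σ (List (V G)) λ S → Σ (V G) λ u → ¬ Closable S u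

    advance : Walker → Walker
    advance (S , u , ¬closable) =
      u ∷ S , neighbours u (proj₁ escape) , proj₂ escape
      where escape = unclosable-neighbour em ¬closable

    unclosable⇒ray : ∀ {u} → ¬ Closable [] u → Ray G
    unclosable⇒ray {u} ¬closable = record
      { vertex    = vertex
      ; injective = fresh⇒injective vertex seen (λ _ → refl) fresh
      ; adjacent  = λ n → proj₂ (proj₂ (δ (vertex n))) _
      }
      where
      walk : ℕ → Walker
      walk zero    = [] , u , ¬closable
      walk (suc n) = advance (walk n)

      seen : ℕ → List (V G)
      seen n = proj₁ (walk n)

      vertex : ℕ → V G
      vertex n = proj₁ (proj₂ (walk n))

      fresh : ∀ n → vertex n ∉ seen n
      fresh n v∈seen = proj₂ (proj₂ (walk n)) (member⇒closable v∈seen)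

mainTheorem2 : ExcludedMiddle 0ℓ → (m : ℕ) (G : Graph) →
    NonEmpty G → Rayless G → MinDegAtLeast G m →
    HasFiniteMinDegSubgraph G m
mainTheorem2 em m G v rayless δ with em {Closability.Closable (neighbours G δ) [] v}
... | yes closable = closable⇒finite-subgraph G δ closable
... | no ¬closable = contradiction (unclosable⇒ray G δ em ¬closable) rayless
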